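{- Let $M$ be a countable $L$-structure and $\mathcal F$ a sharp back-and-forth system on $M$. Then for every $k$ and every $(\bar a,\bar b)\in\mathcal F\cap M^{2k}$ there is $\sigma\in\mathrm{Fix}(M,\mathcal F)$ with $\sigma(\bar a)=\bar b$.
   Context: A back-and-forth system on $M$ is a nonempty set $\mathcal F$ of pairs $(\bar a,\bar b)$ of finite tuples of equal length from $M$ such that $\bar a\mapsto\bar b$ preserves atomic formulas and for each $(\bar a,\bar b)\in\mathcal F$ and $c\in M$ some $d$ has $(\bar ac,\bar bd)\in\mathcal F$, and for each $d$ some $c$ has $(\bar ac,\bar bd)\in\mathcal F$. It is sharp if closed under $(\bar a,\bar b)\mapsto(\bar a{\restriction}f,\bar b{\restriction}f)$ for injections $f:k\to n$ ($\bar a{\restriction}f=(a_{f(0)},\dots,a_{f(k-1)})$) and each $E_k=\mathcal F\cap M^{2k}$ is an equivalence relation on $M^k$. $\mathrm{Fix}(M,\mathcal F)=\{\sigma\in\mathrm{Aut}(M):(\bar c,\sigma(\bar c))\in\mathcal F$ for all $k$ and all $\bar c\in M^k\}$. -}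

module Defs where

open import Data.Nat using (ℕ)
open import Data.Fin using (Fin)
open import Data.Vec using (Vec; map; lookup; tabulate; _∷ʳ_)
open import Data.Product using (Σ; ∃; _×_; _,_)
open import Data.Sum using (_⊎_)
open import Data.Empty using (⊥)
open import Relation.Nullary using (¬_)
open import Relation.Binary.PropositionalEquality using (_≡_)
open import Function.Bundles using (_⇔_)
open import Function.Definitions using (Surjective; Bijective; Injective)

record Signature : Set₁ where
  field
    FunSym : Set
    funArity : FunSym → ℕ
    RelSym : Set
    relArity : RelSym → ℕ
open Signature public

-- An L-structure. Equality of the structure is propositional equality.
record Structure (L : Signature) : Set₁ where
  field
    Carrier : Set
    funI : (f : FunSym L) → Vec Carrier (funArity L f) → Carrier
    relI : (r : RelSym L) → Vec Carrier (relArity L r) → Set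
open Structure public

data Term (L : Signature) (k : ℕ) : Set where
  var : Fin k → Term L k
  app : (f : FunSym L) → Vec (Term L k) (funArity L f) → Term L k

data Atomic (L : Signature) (k : ℕ) : Set where
  equ : Term L k → Term L k → Atomic L k
  rel : (r : RelSym L) → Vec (Term L k) (relArity L r) → Atomic L k

module _ {L : Signature} (M : Structure L) where

  evalTerm : ∀ {k} → Vec (Carrier M) k → Term L k → Carrier M
  evalTerms : ∀ {k n} → Vec (Carrier M) k → Vec (Term L k) n → Vec (Carrier M) n
  evalTerm a (var i) = lookup a i
  evalTerm a (app f ts) = funI M f (evalTerms a ts)
  evalTerms a Vec.[] = Vec.[]
  evalTerms a (t Vec.∷ ts) = evalTerm a t Vec.∷ evalTerms a ts

  Sat : ∀ {k} → Atomic L k → Vec (Carrier M) k → Set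
  Sat (equ s t) a = evalTerm a s ≡ evalTerm a t
  Sat (rel r ts) a = relI M r (evalTerms a ts)

  PreservesAtomic : ∀ {k} → Vec (Carrier M) k → Vec (Carrier M) k → Set
  PreservesAtomic {k} a b = (φ : Atomic L k) → Sat φ a ⇔ Sat φ b

  Countable : Set
  Countable = (¬ Carrier M) ⊎ Σ (ℕ → Carrier M) (λ e → Surjective _≡_ _≡_ e)

  TupleRel : Set₁
  TupleRel = ∀ {k} → Vec (Carrier M) k → Vec (Carrier M) k → Set

  record IsBackAndForth (F : TupleRel) : Set where
    field
      nonempty : Σ ℕ λ k → Σ (Vec (Carrier M) k) λ a → Σ (Vec (Carrier M) k) λ b → F a b
      preserves : ∀ {k} (a b : Vec (Carrier M) k) → F a b → PreservesAtomic a b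
      forth : ∀ {k} (a b : Vec (Carrier M) k) → F a b →
              (c : Carrier M) → Σ (Carrier M) λ d → F (a ∷ʳ c) (b ∷ʳ d)
      back : ∀ {k} (a b : Vec (Carrier M) k) → F a b →
             (d : Carrier M) → Σ (Carrier M) λ c → F (a ∷ʳ c) (b ∷ʳ d)

  restrict : ∀ {n k} → Vec (Carrier M) n → (Fin k → Fin n) → Vec (Carrier M) k
  restrict a f = tabulate (λ i → lookup a (f i))

  record IsSharp (F : TupleRel) : Set where
    field
      backAndForth : IsBackAndForth F
      restrictClosed : ∀ {n k} (f : Fin k → Fin n) → Injective _≡_ _≡_ f →
                       (a b : Vec (Carrier M) n) → F a b → F (restrict a f) (restrict b f)
      E-refl : ∀ {k} (a : Vec (Carrier M) k) → F a a
      E-sym : ∀ {k} (a b : Vec (Carrier M) k) → F a b → F b a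
      E-trans : ∀ {k} (a b c : Vec (Carrier M) k) → F a b → F b c → F a c

  record IsAutomorphism (σ : Carrier M → Carrier M) : Set where
    field
      bijective : Bijective _≡_ _≡_ σ
      preservesFun : (f : FunSym L) (xs : Vec (Carrier M) (funArity L f)) →
                     σ (funI M f xs) ≡ funI M f (map σ xs)
      preservesRel : (r : RelSym L) (xs : Vec (Carrier M) (relArity L r)) →
                     relI M r xs ⇔ relI M r (map σ xs)

  InFix : TupleRel → (Carrier M → Carrier M) → Set
  InFix F σ = IsAutomorphism σ × (∀ k (c : Vec (Carrier M) k) → F c (map σ c))

-- Enumerate M as e 0, e 1, …  Starting from (ā, b̄), alternately go forth with e s and back
-- with e s; this yields an increasing chain of pairs in F whose union is the graph of a
-- bijection σ mapping ā to b̄.  Every tuple c̄ occurs, possibly with repetitions, inside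
-- some stage (Ā, B̄) of the chain, with σ(c̄) at the same positions of B̄; sharpness makes
-- F closed under arbitrary restrictions, so (c̄, σ c̄) ∈ F.  Since F-related tuples satisfy
-- the same atomic formulas, σ is then an automorphism.
module Submission where

open import Defs
open import Data.Nat using (ℕ; zero; suc; _+_; _⊔_; _≤′_; ≤′-refl; ≤′-step)
open import Data.Nat.Properties using (≤⇒≤′; m≤m⊔n; m≤n⊔m)
open import Data.Fin using (Fin; zero; suc; inject₁; fromℕ)
open import Data.Fin.Properties using (inject₁-injective; fromℕ≢inject₁)
open import Data.Vec using (Vec; []; _∷_; _∷ʳ_; map; lookup; tabulate)
open import Data.Vec.Properties using (lookup-map; lookup∘tabulate; tabulate∘lookup; tabulate-cong; map-id)
open import Data.Product using (Σ; _×_; _,_; proj₁; proj₂)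
open import Data.Sum using (inj₁; inj₂)
open import Data.Empty using (⊥-elim)
open import Function using (id; _∘_)
open import Function.Bundles using (Equivalence; mk⇔; _⇔_)
open import Function.Definitions using (Surjective; Injective)
open import Relation.Nullary using (¬_)
open import Relation.Binary.PropositionalEquality
  using (_≡_; refl; sym; trans; cong; subst; subst₂; module ≡-Reasoning)

open ≡-Reasoning

lookup-∷ʳ-inject₁ : ∀ {A : Set} {n} (xs : Vec A n) x (i : Fin n) →
                    lookup (xs ∷ʳ x) (inject₁ i) ≡ lookup xs i
lookup-∷ʳ-inject₁ (y ∷ xs) x zero    = refl
lookup-∷ʳ-inject₁ (y ∷ xs) x (suc i) = lookup-∷ʳ-inject₁ xs x i

lookup-∷ʳ-fromℕ : ∀ {A : Set} {n} (xs : Vec A n) x → lookup (xs ∷ʳ x) (fromℕ n) ≡ x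
lookup-∷ʳ-fromℕ []       x = refl
lookup-∷ʳ-fromℕ (y ∷ xs) x = lookup-∷ʳ-fromℕ xs x

lookup-ext : ∀ {A : Set} {n} {u v : Vec A n} → (∀ i → lookup u i ≡ lookup v i) → u ≡ v
lookup-ext {u = u} {v} eq = begin
  u                   ≡⟨ tabulate∘lookup u ⟨
  tabulate (lookup u) ≡⟨ tabulate-cong eq ⟩
  tabulate (lookup v) ≡⟨ tabulate∘lookup v ⟩
  v                   ∎

Vec-¬-unique : ∀ {A : Set} {n} → ¬ A → (u v : Vec A n) → u ≡ v
Vec-¬-unique ¬A []      []      = refl
Vec-¬-unique ¬A (x ∷ u) (y ∷ v) = ⊥-elim (¬A x)

-- u followed by the duplicates u_{f(n-1)}, …, u_{f(0)}, which sit at the positions new j.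
extendBy : ∀ {A : Set} {m n} → Vec A m → (Fin n → Fin m) → Vec A (n + m)
extendBy {n = zero}  u f = u
extendBy {n = suc n} u f = extendBy u (f ∘ suc) ∷ʳ lookup u (f zero)

old : ∀ {m} n → Fin m → Fin (n + m)
old zero    i = i
old (suc n) i = inject₁ (old n i)

new : ∀ {m n} → Fin n → Fin (n + m)
new {m} {suc n} zero    = fromℕ (n + m)
new {m} {suc n} (suc j) = inject₁ (new j)

new-injective : ∀ {m n} → Injective _≡_ _≡_ (new {m} {n})
new-injective {x = zero}  {y = zero}  eq = refl
new-injective {x = zero}  {y = suc j} eq = ⊥-elim (fromℕ≢inject₁ eq)
new-injective {x = suc i} {y = zero}  eq = ⊥-elim (fromℕ≢inject₁ (sym eq))
new-injective {x = suc i} {y = suc j} eq = cong suc (new-injective (inject₁-injective eq))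

lookup-extendBy-old : ∀ {A : Set} {m n} (u : Vec A m) (f : Fin n → Fin m) i →
                      lookup (extendBy u f) (old n i) ≡ lookup u i
lookup-extendBy-old {n = zero}  u f i = refl
lookup-extendBy-old {n = suc n} u f i =
  trans (lookup-∷ʳ-inject₁ (extendBy u (f ∘ suc)) _ (old n i)) (lookup-extendBy-old u (f ∘ suc) i)

lookup-extendBy-new : ∀ {A : Set} {m n} (u : Vec A m) (f : Fin n → Fin m) j →
                      lookup (extendBy u f) (new j) ≡ lookup u (f j)
lookup-extendBy-new {n = suc n} u f zero    = lookup-∷ʳ-fromℕ (extendBy u (f ∘ suc)) _
lookup-extendBy-new {n = suc n} u f (suc j) =
  trans (lookup-∷ʳ-inject₁ (extendBy u (f ∘ suc)) _ (new j)) (lookup-extendBy-new u (f ∘ suc) j)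

module _ {L : Signature} (M : Structure L) where

  evalTerms-vars : ∀ {n k} (a : Vec (Carrier M) n) (f : Fin k → Fin n) →
                   evalTerms M a (tabulate (λ i → var (f i))) ≡ restrict M a f
  evalTerms-vars {k = zero}  a f = refl
  evalTerms-vars {k = suc k} a f = cong (lookup a (f zero) ∷_) (evalTerms-vars a (f ∘ suc))

  evalTerms-var : ∀ {n} (a : Vec (Carrier M) n) → evalTerms M a (tabulate var) ≡ a
  evalTerms-var a = trans (evalTerms-vars a id) (tabulate∘lookup a)

  evalTerms-var-suc : ∀ {n} x (a : Vec (Carrier M) n) →
                      evalTerms M (x ∷ a) (tabulate (λ i → var (suc i))) ≡ a
  evalTerms-var-suc x a = trans (evalTerms-vars (x ∷ a) suc) (tabulate∘lookup a)

  -- Equality, f(x̄) = y and r(x̄) are atomic, so a map preserving atomic formulas on all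
  -- tuples is an injective strong homomorphism.
  module _ {σ : Carrier M → Carrier M}
           (pres : ∀ {k} (c : Vec (Carrier M) k) → PreservesAtomic M c (map σ c)) where

    preservesAtomic⇒injective : Injective _≡_ _≡_ σ
    preservesAtomic⇒injective {x} {y} =
      Equivalence.from (pres (x ∷ y ∷ []) (equ (var zero) (var (suc zero))))

    preservesAtomic⇒preservesFun : (f : FunSym L) (xs : Vec (Carrier M) (funArity L f)) →
                                   σ (funI M f xs) ≡ funI M f (map σ xs)
    preservesAtomic⇒preservesFun f xs =
      trans (Equivalence.to (pres (funI M f xs ∷ xs) φ) sat)
            (cong (funI M f) (evalTerms-var-suc _ (map σ xs)))
      where
      φ : Atomic L (suc (funArity L f))
      φ = equ (var zero) (app f (tabulate (λ i → var (suc i))))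
      sat : Sat M φ (funI M f xs ∷ xs)
      sat = cong (funI M f) (sym (evalTerms-var-suc _ xs))

    preservesAtomic⇒preservesRel : (r : RelSym L) (xs : Vec (Carrier M) (relArity L r)) →
                                   relI M r xs ⇔ relI M r (map σ xs)
    preservesAtomic⇒preservesRel r xs =
      subst₂ _⇔_ (cong (relI M r) (evalTerms-var xs)) (cong (relI M r) (evalTerms-var (map σ xs)))
             (pres xs (rel r (tabulate var)))

    preservesAtomic⇒automorphism : Surjective _≡_ _≡_ σ → IsAutomorphism M σ
    preservesAtomic⇒automorphism surj = record
      { bijective    = preservesAtomic⇒injective , surj
      ; preservesFun = preservesAtomic⇒preservesFun
      ; preservesRel = preservesAtomic⇒preservesRel
      }

  id-inFix : {F : TupleRel M} → (∀ {k} (c : Vec (Carrier M) k) → F c c) → InFix M F id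
  id-inFix {F} F-refl =
    preservesAtomic⇒automorphism pres-id (λ y → y , id) , λ k c → subst (F c) (sym (map-id c)) (F-refl c)
    where
    pres-id : ∀ {k} (c : Vec (Carrier M) k) → PreservesAtomic M c (map id c)
    pres-id c = subst (PreservesAtomic M c) (sym (map-id c)) (λ φ → mk⇔ id id)

module _ {L : Signature} {M : Structure L} {F : TupleRel M} (bf : IsBackAndForth M F) where

  open IsBackAndForth bf

  F-respects-≡ : ∀ {n} {u v : Vec (Carrier M) n} → F u v →
                 ∀ i j → lookup u i ≡ lookup u j → lookup v i ≡ lookup v j
  F-respects-≡ {u = u} {v} r i j = Equivalence.to (preserves u v r (equ (var i) (var j)))

  forth-determined : ∀ {n} {u v : Vec (Carrier M) n} {x y} (i : Fin n) → F u v →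
                     lookup u i ≡ x → lookup v i ≡ y → F (u ∷ʳ x) (v ∷ʳ y)
  forth-determined {n} {u} {v} {x} {y} i r ui≡x vi≡y = subst (λ z → F (u ∷ʳ x) (v ∷ʳ z)) d≡y r′
    where
    d  = proj₁ (forth u v r x)
    r′ = proj₂ (forth u v r x)
    x-twice : lookup (u ∷ʳ x) (fromℕ n) ≡ lookup (u ∷ʳ x) (inject₁ i)
    x-twice = trans (lookup-∷ʳ-fromℕ u x) (sym (trans (lookup-∷ʳ-inject₁ u x i) ui≡x))
    d≡y : d ≡ y
    d≡y = begin
      d                          ≡⟨ lookup-∷ʳ-fromℕ v d ⟨
      lookup (v ∷ʳ d) (fromℕ n)   ≡⟨ F-respects-≡ r′ (fromℕ n) (inject₁ i) x-twice ⟩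
      lookup (v ∷ʳ d) (inject₁ i) ≡⟨ lookup-∷ʳ-inject₁ v d i ⟩
      lookup v i                 ≡⟨ vi≡y ⟩
      y                          ∎

  F-extendBy : ∀ {m n} {u v : Vec (Carrier M) m} → F u v → (f : Fin n → Fin m) →
               F (extendBy u f) (extendBy v f)
  F-extendBy {n = zero}          r f = r
  F-extendBy {n = suc n} {u} {v} r f =
    forth-determined (old n (f zero)) (F-extendBy r (f ∘ suc))
      (lookup-extendBy-old u (f ∘ suc) (f zero)) (lookup-extendBy-old v (f ∘ suc) (f zero))

-- Sharpness only grants closure under injective restrictions; the duplicates supplied by
-- extendBy make every restriction injective.
restrict-closed : ∀ {L} {M : Structure L} {F : TupleRel M} → IsSharp M F →
                  ∀ {m n} {u v : Vec (Carrier M) m} → F u v → (f : Fin n → Fin m) →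
                  F (restrict M u f) (restrict M v f)
restrict-closed {M = M} {F} sh {u = u} {v} r f =
  subst₂ F (restrict-new u) (restrict-new v)
    (IsSharp.restrictClosed sh new new-injective _ _ (F-extendBy (IsSharp.backAndForth sh) r f))
  where
  restrict-new : ∀ w → restrict M (extendBy w f) new ≡ restrict M w f
  restrict-new w = tabulate-cong (lookup-extendBy-new w f)

module Chain {L : Signature} {M : Structure L} {F : TupleRel M} (sh : IsSharp M F)
             (e : ℕ → Carrier M) (e-surjective : Surjective _≡_ _≡_ e)
             {k : ℕ} (a b : Vec (Carrier M) k) (ab : F a b) where

  open IsSharp sh
  open IsBackAndForth backAndForth

  C : Set
  C = Carrier M

  record Approx (n : ℕ) : Set where
    field
      dom cod : Vec C n
      related : F dom cod
  open Approx

  forthBack : ∀ {n} → Approx n → C → Approx (suc (suc n))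
  forthBack p x = record
    { dom     = (dom p ∷ʳ x) ∷ʳ proj₁ bk
    ; cod     = (cod p ∷ʳ proj₁ fw) ∷ʳ x
    ; related = proj₂ bk
    }
    where
    fw = forth (dom p) (cod p) (related p) x
    bk = back (dom p ∷ʳ x) (cod p ∷ʳ proj₁ fw) (proj₂ fw) x

  len : ℕ → ℕ
  len zero    = k
  len (suc s) = suc (suc (len s))

  stage : ∀ s → Approx (len s)
  stage zero    = record { dom = a ; cod = b ; related = ab }
  stage (suc s) = forthBack (stage s) (e s)

  A B : ∀ s → Vec C (len s)
  A s = dom (stage s)
  B s = cod (stage s)

  grow : ∀ {s t} → s ≤′ t → Fin (len s) → Fin (len t)
  grow ≤′-refl      i = i
  grow (≤′-step p) i = inject₁ (inject₁ (grow p i))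

  lookup-grow : (V : ∀ s → Vec C (len s)) →
                (∀ s i → lookup (V (suc s)) (inject₁ (inject₁ i)) ≡ lookup (V s) i) →
                ∀ {s t} (p : s ≤′ t) i → lookup (V t) (grow p i) ≡ lookup (V s) i
  lookup-grow V V-step ≤′-refl      i = refl
  lookup-grow V V-step (≤′-step p) i = trans (V-step _ (grow p i)) (lookup-grow V V-step p i)

  lookup-grow-A : ∀ {s t} (p : s ≤′ t) i → lookup (A t) (grow p i) ≡ lookup (A s) i
  lookup-grow-A = lookup-grow A λ s i →
    trans (lookup-∷ʳ-inject₁ (A s ∷ʳ e s) _ (inject₁ i)) (lookup-∷ʳ-inject₁ (A s) (e s) i)

  lookup-grow-B : ∀ {s t} (p : s ≤′ t) i → lookup (B t) (grow p i) ≡ lookup (B s) i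
  lookup-grow-B = lookup-grow B λ s i →
    trans (lookup-∷ʳ-inject₁ (B s ∷ʳ _) (e s) (inject₁ i)) (lookup-∷ʳ-inject₁ (B s) _ i)

  A-agree⇒B-agree : ∀ s t i j → lookup (A s) i ≡ lookup (A t) j → lookup (B s) i ≡ lookup (B t) j
  A-agree⇒B-agree s t i j eq = begin
    lookup (B s) i            ≡⟨ lookup-grow-B s≤u i ⟨
    lookup (B u) (grow s≤u i) ≡⟨ F-respects-≡ backAndForth (related (stage u)) _ _ A-eq ⟩
    lookup (B u) (grow t≤u j) ≡⟨ lookup-grow-B t≤u j ⟩
    lookup (B t) j            ∎
    where
    u   = s ⊔ t
    s≤u = ≤⇒≤′ (m≤m⊔n s t)
    t≤u = ≤⇒≤′ (m≤n⊔m s t)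
    A-eq = trans (lookup-grow-A s≤u i) (trans eq (sym (lookup-grow-A t≤u j)))

  index : C → ℕ
  index x = proj₁ (e-surjective x)

  e-index : ∀ x → e (index x) ≡ x
  e-index x = proj₂ (e-surjective x) refl

  lookup-A-e : ∀ s → lookup (A (suc s)) (inject₁ (fromℕ (len s))) ≡ e s
  lookup-A-e s = trans (lookup-∷ʳ-inject₁ (A s ∷ʳ e s) _ (fromℕ (len s))) (lookup-∷ʳ-fromℕ (A s) (e s))

  lookup-B-e : ∀ s → lookup (B (suc s)) (fromℕ (suc (len s))) ≡ e s
  lookup-B-e s = lookup-∷ʳ-fromℕ (B s ∷ʳ _) (e s)

  σ : C → C
  σ x = lookup (B (suc (index x))) (inject₁ (fromℕ (len (index x))))

  σ-A : ∀ s i → σ (lookup (A s) i) ≡ lookup (B s) i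
  σ-A s i = A-agree⇒B-agree (suc n) s _ i (trans (lookup-A-e n) (e-index (lookup (A s) i)))
    where n = index (lookup (A s) i)

  map-σ-A : ∀ s → map σ (A s) ≡ B s
  map-σ-A s = lookup-ext λ i → trans (lookup-map i σ (A s)) (σ-A s i)

  σ-surjective : Surjective _≡_ _≡_ σ
  σ-surjective y = lookup (A (suc n)) (fromℕ (suc (len n))) ,
    λ { refl → trans (σ-A (suc n) _) (trans (lookup-B-e n) (e-index y)) }
    where n = index y

  Occurs : ℕ → C → Set
  Occurs s x = Σ (Fin (len s)) λ i → lookup (A s) i ≡ x

  occurs-grow : ∀ {s t x} → s ≤′ t → Occurs s x → Occurs t x
  occurs-grow p (i , eq) = grow p i , trans (lookup-grow-A p i) eq

  occurs-index : ∀ x → Occurs (suc (index x)) x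
  occurs-index x = inject₁ (fromℕ (len (index x))) , trans (lookup-A-e (index x)) (e-index x)

  occurs-all : ∀ {n} (c : Vec C n) → Σ ℕ λ t → ∀ j → Occurs t (lookup c j)
  occurs-all []      = 0 , λ ()
  occurs-all (x ∷ c) = t ⊔ s , λ
    { zero    → occurs-grow (≤⇒≤′ (m≤n⊔m t s)) (occurs-index x)
    ; (suc j) → occurs-grow (≤⇒≤′ (m≤m⊔n t s)) (occ j)
    }
    where
    s   = suc (index x)
    t   = proj₁ (occurs-all c)
    occ = proj₂ (occurs-all c)

  σ-fixes : ∀ {n} (c : Vec C n) → F c (map σ c)
  σ-fixes c = subst₂ F c-eq σc-eq (restrict-closed sh (related (stage t)) pos)
    where
    t   = proj₁ (occurs-all c)
    occ = proj₂ (occurs-all c)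
    pos : _ → Fin (len t)
    pos j = proj₁ (occ j)
    c-eq : restrict M (A t) pos ≡ c
    c-eq = lookup-ext λ j → trans (lookup∘tabulate _ j) (proj₂ (occ j))
    σc-eq : restrict M (B t) pos ≡ map σ c
    σc-eq = lookup-ext λ j → begin
      lookup (restrict M (B t) pos) j ≡⟨ lookup∘tabulate _ j ⟩
      lookup (B t) (pos j)            ≡⟨ σ-A t (pos j) ⟨
      σ (lookup (A t) (pos j))        ≡⟨ cong σ (proj₂ (occ j)) ⟩
      σ (lookup c j)                  ≡⟨ lookup-map j σ c ⟨
      lookup (map σ c) j              ∎

  σ-inFix : InFix M F σ
  σ-inFix = preservesAtomic⇒automorphism M (λ c → preserves _ _ (σ-fixes c)) σ-surjective ,
            λ _ c → σ-fixes c

lemma4p5 : {L : Signature} (M : Structure L) → Countable M →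
    (F : TupleRel M) → IsSharp M F →
    (k : ℕ) (a b : Vec (Carrier M) k) → F a b →
    Σ (Carrier M → Carrier M) λ σ → InFix M F σ × (map σ a ≡ b)
lemma4p5 M (inj₁ empty)     F sh k a b ab = id , id-inFix M {F} (IsSharp.E-refl sh) , Vec-¬-unique empty _ b
lemma4p5 M (inj₂ (e , surj)) F sh k a b ab = σ , σ-inFix , map-σ-A 0
  where open Chain sh e surj a b ab
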